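{- For every integer $d\ge 2$, the mutual-visibility number of the $d$-dimensional butterfly satisfies $\mu(\mathit{BF}(d)) = 2^{d+1}-2$.
   Context: All graphs are finite, simple, undirected and connected; distances are shortest-path distances. For a graph $G$ and $X\subseteq V(G)$, two vertices $x,y\in V(G)$ are $X$-visible if there is a shortest $x,y$-path none of whose internal vertices lies in $X$. $X$ is a mutual-visibility set if every two vertices of $X$ are $X$-visible; $\mu(G)$ is the maximum cardinality of a mutual-visibility set of $G$. The $d$-dimensional butterfly $\mathit{BF}(d)$ has vertex set $\{[\ell,c] : \ell\in\{0,1,\dots,d\},\ c\in\{0,1\}^d\}$ ($\ell$ is the level, $c$ the column, a binary string of length $d$); for $\ell\in\{1,\dots,d\}$, the vertex $[\ell-1,c]$ is adjacent to $[\ell,c']$ if and only if either $c=c'$ or $c$ and $c'$ differ exactly in the $\ell$-th bit (bits counted from the left starting at 1); there are no other edges. -}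

module Defs where

open import Level using (Level; _⊔_) renaming (suc to lsuc)
open import Data.Nat using (ℕ; zero; suc; _+_; _≤_)
open import Data.Bool using (Bool; not)
open import Data.Fin using (Fin; inject₁) renaming (suc to fsuc)
open import Data.Vec using (Vec; _[_]%=_)
open import Data.Product using (_×_; _,_; ∃; ∃-syntax)
open import Data.Sum using (_⊎_)
open import Data.List using (List; []; _∷_; length)
open import Data.List.Membership.Propositional using (_∈_)
open import Data.List.Relation.Unary.All using (All)
open import Data.List.Relation.Unary.Unique.Propositional using (Unique)
open import Relation.Nullary using (¬_)
open import Relation.Binary.PropositionalEquality using (_≡_)

module _ {a ℓ : Level} {V : Set a} (Adj : V → V → Set ℓ) where

  data Walk : V → V → Set (a ⊔ ℓ) where
    here : (x : V) → Walk x x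
    step : {x y z : V} → Adj x y → Walk y z → Walk x z

  wlen : {x y : V} → Walk x y → ℕ
  wlen (here _)   = zero
  wlen (step _ w) = suc (wlen w)

  internal : {x y : V} → Walk x y → List V
  internal (here _) = []
  internal (step _ (here _)) = []
  internal (step {y = y} _ w@(step _ _)) = y ∷ internal w

  IsShortest : {x y : V} → Walk x y → Set (a ⊔ ℓ)
  IsShortest {x} {y} p = (q : Walk x y) → wlen p ≤ wlen q

  Visible : List V → V → V → Set (a ⊔ ℓ)
  Visible X x y =
    ∃[ p ] (IsShortest {x} {y} p × All (λ v → ¬ (v ∈ X)) (internal p))

  MutualVis : List V → Set (a ⊔ ℓ)
  MutualVis X = ∀ {x y} → x ∈ X → y ∈ X → Visible X x y

  IsMu : ℕ → Set (a ⊔ ℓ)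
  IsMu n =
    (∃[ X ] (Unique X × MutualVis X × length X ≡ n))
    × (∀ X → Unique X → MutualVis X → length X ≤ n)

-- The d-dimensional butterfly BF(d).
-- Vertex [ℓ , c]: level ℓ ∈ {0..d} (Fin (suc d)), column c ∈ {0,1}^d.
-- Bit ℓ (1-indexed from the left) of c is the Vec entry at index ℓ-1.

BV : ℕ → Set
BV d = Fin (suc d) × Vec Bool d

-- edges between level k and level k+1 (k : Fin d, i.e. ℓ = k+1 ∈ {1..d})
data BEdge {d : ℕ} : BV d → BV d → Set where
  straight : (k : Fin d) (c : Vec Bool d) →
             BEdge (inject₁ k , c) (fsuc k , c)
  cross    : (k : Fin d) (c : Vec Bool d) →
             BEdge (inject₁ k , c) (fsuc k , c [ k ]%= not)

BAdj : (d : ℕ) → BV d → BV d → Set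
BAdj d u v = BEdge u v ⊎ BEdge v u

-- Lower bound: take the vertices on levels 0 and d whose column is not all-false. Two bottom
-- vertices are joined by a geodesic that climbs to the level just above their highest differing
-- bit and comes back down, turning in a column whose lower bits are all false; dually for two
-- top vertices. All other internal vertices lie on the middle levels, so none is in the set.
--
-- Upper bound: write u ≼ w when w is reached from u by going straight up. A geodesic between
-- comparable vertices is such a straight climb and passes through everything between them, so a
-- mutual-visibility set X contains no three-element chain; its minimal elements L and the
-- remaining ones U are therefore antichains. Translating columns shows that an antichain has at
-- most 2^d elements, and fewer if it avoids a whole track (a straight climb extended over all
-- levels). If |X| ≥ 2^(d+1) − 1, one of L, U is full and the other has more than 2^(d−1)
-- elements, hence contains twins differing only in the last (for L) or first (for U) bit. A
-- geodesic between these twins crosses the top (bottom) level and sweeps a whole track, which the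
-- full antichain would have to meet.

module Submission where

open import Defs
open import Level using (Level)
open import Function using (_∘_)
open import Data.Nat using (ℕ; zero; suc; _+_; _∸_; _^_; _≤_; _<_; z≤n; s≤s; s≤s⁻¹; _≟_; _≤?_; _<?_)
open import Data.Nat.Properties
open import Data.Nat.Tactic.RingSolver using (solve-∀)
open import Algebra.Properties.CommutativeSemigroup +-commutativeSemigroup using (interchange)
open import Data.Bool using (Bool; true; false; not; if_then_else_; _xor_)
open import Data.Bool.Properties using (¬-not; xor-same; xor-assoc; xor-identityˡ; xor-identityʳ)
  renaming (_≟_ to _≟ᵇ_)
open import Data.Fin using (Fin; toℕ; fromℕ; inject₁; lower₁; punchOut)
  renaming (zero to fzero; suc to fsuc; _≟_ to _≟ᶠ_)
open import Data.Fin.Properties using (toℕ-injective; toℕ-inject₁; inject₁-lower₁; toℕ-fromℕ; toℕ<n; all?)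
open import Data.Vec using (Vec; []; _∷_; lookup; tabulate; replicate; zipWith; removeAt; _[_]%=_)
open import Data.Vec.Properties
  using (lookup∘tabulate; tabulate∘lookup; tabulate-cong; lookup∘updateAt; lookup∘updateAt′; lookup-zipWith;
         removeAt-punchOut; ≡-dec)
open import Data.Product using (Σ-syntax; _×_; _,_; proj₁; proj₂)
open import Data.Product.Properties using () renaming (≡-dec to ×-≡-dec)
open import Data.Sum as Sum using (_⊎_; inj₁; inj₂; [_,_]; swap)
open import Data.Empty using (⊥; ⊥-elim)
open import Data.List using (List; []; _∷_; length; map; _++_; filter)
open import Data.List.Properties using (length-++; length-map)
open import Data.List.Membership.Propositional using (_∈_; _∉_; find; lose)
open import Data.List.Membership.Propositional.Properties using (∈-map⁺; ∈-map⁻; ∈-++⁺ˡ; ∈-++⁺ʳ; ∈-++⁻; ∈-filter⁻)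
open import Data.List.Relation.Unary.Any using (Any; here; there; any?)
open import Data.List.Relation.Unary.All as All using (All)
open import Data.List.Relation.Unary.AllPairs using ([]; _∷_)
open import Data.List.Relation.Unary.Unique.Propositional using (Unique)
open import Data.List.Relation.Unary.Unique.Propositional.Properties using (map⁺; ++⁺; filter⁺)
open import Relation.Nullary using (¬_; Dec; yes; no; does; contradiction)
open import Relation.Nullary.Decidable using (_×-dec_; _→-dec_; ¬?; map′; dec-true; dec-false)
open import Relation.Unary using (Decidable)
open import Relation.Unary.Properties using (∁?)
open import Relation.Binary using (Symmetric)
open import Relation.Binary.PropositionalEquality
  using (_≡_; _≢_; refl; sym; trans; cong; cong₂; subst; module ≡-Reasoning)

module WalkProperties {a ℓ : Level} {V : Set a} {Adj : V → V → Set ℓ} where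

  private
    variable
      x y z v : V

  infixr 5 _++ʷ_

  _++ʷ_ : Walk Adj x y → Walk Adj y z → Walk Adj x z
  here _   ++ʷ q = q
  step e p ++ʷ q = step e (p ++ʷ q)

  wlen-++ : (p : Walk Adj x y) (q : Walk Adj y z) → wlen Adj (p ++ʷ q) ≡ wlen Adj p + wlen Adj q
  wlen-++ (here _)   q = refl
  wlen-++ (step e p) q = cong suc (wlen-++ p q)

  ∈-internal-++⁻ : (p : Walk Adj x y) (q : Walk Adj y z) → v ∈ internal Adj (p ++ʷ q) →
                   v ∈ internal Adj p ⊎ v ≡ y ⊎ v ∈ internal Adj q
  ∈-internal-++⁻ (here _)              q          m         = inj₂ (inj₂ m)
  ∈-internal-++⁻ (step e (here _))     (step _ _) (here eq) = inj₂ (inj₁ eq)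
  ∈-internal-++⁻ (step e (here _))     (step _ _) (there m) = inj₂ (inj₂ m)
  ∈-internal-++⁻ (step e p@(step _ _)) q          (here eq) = inj₁ (here eq)
  ∈-internal-++⁻ (step e p@(step _ _)) q          (there m) with ∈-internal-++⁻ p q m
  ... | inj₁ m′ = inj₁ (there m′)
  ... | inj₂ r  = inj₂ r

  ∈-internal-++⁺ˡ : (p : Walk Adj x y) (q : Walk Adj y z) → v ∈ internal Adj p → v ∈ internal Adj (p ++ʷ q)
  ∈-internal-++⁺ˡ (step e (step _ _))   q (here eq) = here eq
  ∈-internal-++⁺ˡ (step e p@(step _ _)) q (there m) = there (∈-internal-++⁺ˡ p q m)

  junction-∈-internal : (p : Walk Adj x y) (q : Walk Adj y z) → 0 < wlen Adj p → 0 < wlen Adj q →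
                        y ∈ internal Adj (p ++ʷ q)
  junction-∈-internal (step e (here _))     (step _ _) _ _ = here refl
  junction-∈-internal (step e p@(step _ _)) q          _ h = there (junction-∈-internal p q (s≤s z≤n) h)

  ∈-internal-step⁻ : (e : Adj x y) (q : Walk Adj y z) → v ∈ internal Adj (step e q) →
                     (v ≡ y × 0 < wlen Adj q) ⊎ v ∈ internal Adj q
  ∈-internal-step⁻ e (step _ _) (here eq) = inj₁ (eq , s≤s z≤n)
  ∈-internal-step⁻ e (step _ _) (there m) = inj₂ m

  ∈-internal-step⁺ : (e : Adj x y) (q : Walk Adj y z) → v ∈ internal Adj q → v ∈ internal Adj (step e q)
  ∈-internal-step⁺ e (step _ _) m = there m

  start-∈-internal-step : (e : Adj x y) (q : Walk Adj y z) → 0 < wlen Adj q → y ∈ internal Adj (step e q)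
  start-∈-internal-step e (step _ _) _ = here refl

  ≢⇒0<wlen : (p : Walk Adj x y) → x ≢ y → 0 < wlen Adj p
  ≢⇒0<wlen (here _)   x≢x = contradiction refl x≢x
  ≢⇒0<wlen (step _ _) _   = s≤s z≤n

  module _ (Adj-sym : Symmetric Adj) where

    reverse : Walk Adj x y → Walk Adj y x
    reverse (here x)   = here x
    reverse (step e p) = reverse p ++ʷ step (Adj-sym e) (here _)

    wlen-reverse : (p : Walk Adj x y) → wlen Adj (reverse p) ≡ wlen Adj p
    wlen-reverse (here _)   = refl
    wlen-reverse (step e p) = begin
      wlen Adj (reverse p ++ʷ step (Adj-sym e) (here _)) ≡⟨ wlen-++ (reverse p) _ ⟩
      wlen Adj (reverse p) + 1                         ≡⟨ cong (_+ 1) (wlen-reverse p) ⟩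
      wlen Adj p + 1                                   ≡⟨ +-comm (wlen Adj p) 1 ⟩
      suc (wlen Adj p)                                 ∎
      where open ≡-Reasoning

    ∈-internal-reverse⁻ : (p : Walk Adj x y) → v ∈ internal Adj (reverse p) → v ∈ internal Adj p
    ∈-internal-reverse⁻ (step e (here _))     ()
    ∈-internal-reverse⁻ (step e p@(step _ _)) m =
      [ there ∘ ∈-internal-reverse⁻ p , [ here , (λ ()) ] ] (∈-internal-++⁻ (reverse p) _ m)

    Visible-sym : ∀ {X} → Visible Adj X x y → Visible Adj X y x
    Visible-sym (p , shortest , avoids) =
      reverse p ,
      (λ q → ≤-trans (≤-reflexive (wlen-reverse p))
               (≤-trans (shortest (reverse q)) (≤-reflexive (wlen-reverse q)))) ,
      All.tabulate (λ m → All.lookup avoids (∈-internal-reverse⁻ p m))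

open WalkProperties

module _ {A : Set} where

  remove : {x : A} {ys : List A} → x ∈ ys → List A
  remove {ys = _ ∷ ys} (here _)  = ys
  remove {ys = y ∷ _}  (there m) = y ∷ remove m

  length-remove : {x : A} {ys : List A} (m : x ∈ ys) → length ys ≡ suc (length (remove m))
  length-remove (here _)  = refl
  length-remove (there m) = cong suc (length-remove m)

  ∈-remove⁺ : {x y : A} {ys : List A} (m : x ∈ ys) → y ∈ ys → y ≢ x → y ∈ remove m
  ∈-remove⁺ (here refl) (here refl) y≢x = contradiction refl y≢x
  ∈-remove⁺ (here refl) (there m′)  _   = m′
  ∈-remove⁺ (there m)   (here eq)   _   = here eq
  ∈-remove⁺ (there m)   (there m′)  y≢x = there (∈-remove⁺ m m′ y≢x)

  Unique⇒length-≤ : {xs ys : List A} → Unique xs → (∀ {x} → x ∈ xs → x ∈ ys) → length xs ≤ length ys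
  Unique⇒length-≤ {[]}     _              _   = z≤n
  Unique⇒length-≤ {x ∷ xs} {ys} (x∉xs ∷ u) xs⊆ys = begin
    suc (length xs)                ≤⟨ s≤s (Unique⇒length-≤ u xs⊆rest) ⟩
    suc (length (remove x∈ys))     ≡⟨ length-remove x∈ys ⟨
    length ys                      ∎
    where
    open ≤-Reasoning
    x∈ys = xs⊆ys (here refl)
    xs⊆rest : ∀ {y} → y ∈ xs → y ∈ remove x∈ys
    xs⊆rest m = ∈-remove⁺ x∈ys (xs⊆ys (there m)) (λ y≡x → All.lookup x∉xs m (sym y≡x))

  Unique⇒length-< : {xs ys : List A} {c : A} → Unique xs → (∀ {x} → x ∈ xs → x ∈ ys) →
                    c ∈ ys → c ∉ xs → length xs < length ys
  Unique⇒length-< u xs⊆ys c∈ys c∉xs =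
    ≤-trans (s≤s (Unique⇒length-≤ u (λ m → ∈-remove⁺ c∈ys (xs⊆ys m) (λ { refl → c∉xs m }))))
            (≤-reflexive (sym (length-remove c∈ys)))

  Unique-map : {B : Set} (f : A → B) {xs : List A} → Unique xs →
               (∀ {v w} → v ∈ xs → w ∈ xs → f v ≡ f w → v ≡ w) → Unique (map f xs)
  Unique-map f {[]}     []         _   = []
  Unique-map f {x ∷ xs} (x∉xs ∷ u) inj =
    All.tabulate fx∉ ∷ Unique-map f u (λ v∈ w∈ → inj (there v∈) (there w∈))
    where
    fx∉ : ∀ {b} → b ∈ map f xs → f x ≢ b
    fx∉ m fx≡b with w , w∈xs , refl ← ∈-map⁻ f m = All.lookup x∉xs w∈xs (inj (here refl) (there w∈xs) fx≡b)

  length-filter+∁ : {P : A → Set} (P? : Decidable P) (xs : List A) →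
                    length (filter P? xs) + length (filter (∁? P?) xs) ≡ length xs
  length-filter+∁ P? []       = refl
  length-filter+∁ P? (x ∷ xs) with P? x
  ... | yes _ = cong suc (length-filter+∁ P? xs)
  ... | no  _ = trans (+-suc _ _) (cong suc (length-filter+∁ P? xs))

private
  variable
    d n : ℕ

level : BV d → ℕ
level = toℕ ∘ proj₁

column : BV d → Vec Bool d
column = proj₂

bit : BV d → Fin d → Bool
bit = lookup ∘ column

level≤d : (v : BV d) → level v ≤ d
level≤d v = s≤s⁻¹ (toℕ<n (proj₁ v))

Path : BV d → BV d → Set
Path {d} = Walk (BAdj d)

len : {x y : BV d} → Path x y → ℕ
len {d} = wlen (BAdj d)

inner : {x y : BV d} → Path x y → List (BV d)
inner {d} = internal (BAdj d)

BAdj-sym : Symmetric (BAdj d)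
BAdj-sym = swap

Vec-ext : {c c′ : Vec Bool n} → (∀ i → lookup c i ≡ lookup c′ i) → c ≡ c′
Vec-ext {c = c} {c′} eq = trans (sym (tabulate∘lookup c)) (trans (tabulate-cong eq) (tabulate∘lookup c′))

vertex-ext : {u v : BV d} → level u ≡ level v → (∀ i → bit u i ≡ bit v i) → u ≡ v
vertex-ext eq bits = cong₂ _,_ (toℕ-injective eq) (Vec-ext bits)

record Ascent {d} (u v : BV d) : Set where
  field
    level-suc : level v ≡ suc (level u)
    bit-fixed : ∀ i → toℕ i ≢ level u → bit v i ≡ bit u i

open Ascent

edge-ascent : {u v : BV d} → BEdge u v → Ascent u v
edge-ascent (straight k c) = record
  { level-suc = cong suc (sym (toℕ-inject₁ k))
  ; bit-fixed = λ _ _ → refl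
  }
edge-ascent (cross k c) = record
  { level-suc = cong suc (sym (toℕ-inject₁ k))
  ; bit-fixed = λ i i≢k → lookup∘updateAt′ i k (λ i≡k → i≢k (trans (cong toℕ i≡k) (sym (toℕ-inject₁ k)))) c
  }

adjacent-ascent : {u v : BV d} → BAdj d u v → Ascent u v ⊎ Ascent v u
adjacent-ascent = Sum.map edge-ascent edge-ascent

ascent-flips-at-level : {u v : BV d} → Ascent u v → ∀ {i} → bit u i ≢ bit v i → toℕ i ≡ level u
ascent-flips-at-level {u = u} asc {i} flips with toℕ i ≟ level u
... | yes i≡u = i≡u
... | no  i≢u = contradiction (sym (bit-fixed asc i i≢u)) flips

toℕ-≡-inject₁⇒≡ : {i k : Fin n} → toℕ i ≡ toℕ (inject₁ k) → i ≡ k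
toℕ-≡-inject₁⇒≡ {k = k} eq = toℕ-injective (trans eq (toℕ-inject₁ k))

edge-up-copying-bit : (t : BV d) → level t < d → (c′ : Vec Bool d) →
                      Σ[ t′ ∈ BV d ] BEdge t t′ × (∀ i → toℕ i ≡ level t → bit t′ i ≡ lookup c′ i)
edge-up-copying-bit (l , c) l<d c′
  with lower₁ l (<⇒≢ l<d ∘ sym) | inject₁-lower₁ l (<⇒≢ l<d ∘ sym)
... | k | refl with lookup c′ k ≟ᵇ lookup c k
...   | yes same = (fsuc k , c) , straight k c , λ i i≡k →
  subst (λ j → lookup c j ≡ lookup c′ j) (sym (toℕ-≡-inject₁⇒≡ i≡k)) (sym same)
...   | no  differ = (fsuc k , c [ k ]%= not) , cross k c , λ i i≡k →
  subst (λ j → lookup (c [ k ]%= not) j ≡ lookup c′ j) (sym (toℕ-≡-inject₁⇒≡ i≡k))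
        (trans (lookup∘updateAt k c) (sym (¬-not differ)))

adjacent-level-≤ : {x y : BV d} → BAdj d x y → level y ≤ suc (level x)
adjacent-level-≤ e with adjacent-ascent e
... | inj₁ x↗y = ≤-reflexive (level-suc x↗y)
... | inj₂ y↗x = m≤n⇒m≤1+n (≤-trans (n≤1+n _) (≤-reflexive (sym (level-suc y↗x))))

level-≤-len : {x y : BV d} (p : Path x y) → level y ≤ len p + level x
level-≤-len (here _) = ≤-refl
level-≤-len {x = x} {y} (step {y = x′} e q) = begin
  level y               ≤⟨ level-≤-len q ⟩
  len q + level x′      ≤⟨ +-monoʳ-≤ (len q) (adjacent-level-≤ e) ⟩
  len q + suc (level x) ≡⟨ +-suc (len q) (level x) ⟩
  suc (len q + level x) ∎
  where open ≤-Reasoning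

level-≤-len′ : {x y : BV d} (p : Path x y) → level x ≤ len p + level y
level-≤-len′ p = subst (λ n → _ ≤ n + _) (wlen-reverse BAdj-sym p) (level-≤-len (reverse BAdj-sym p))

record Split {d} {x y : BV d} (p : Path x y) (a : BV d) : Set where
  field
    prefix : Path x a
    suffix : Path a y
    splits : prefix ++ʷ suffix ≡ p

  len-split : len prefix + len suffix ≡ len p
  len-split = trans (sym (wlen-++ prefix suffix)) (cong len splits)

  prefix-inner⊆ : ∀ {v} → v ∈ inner prefix → v ∈ inner p
  prefix-inner⊆ m = subst (λ r → _ ∈ inner r) splits (∈-internal-++⁺ˡ prefix suffix m)

  junction-∈-inner : 0 < len prefix → 0 < len suffix → a ∈ inner p
  junction-∈-inner h h′ = subst (λ r → a ∈ inner r) splits (junction-∈-internal prefix suffix h h′)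

open Split

Split-step : {x x′ y a : BV d} (e : BAdj d x x′) {q : Path x′ y} → Split q a → Split (step e q) a
Split-step e s = record { prefix = step e (prefix s) ; suffix = suffix s ; splits = cong (step e) (splits s) }

Split-start : {x y : BV d} (p : Path x y) → Split p x
Split-start p = record { prefix = here _ ; suffix = p ; splits = refl }

Split-second : {x x′ y : BV d} (e : BAdj d x x′) (q : Path x′ y) → Split (step e q) x′
Split-second e q = record { prefix = step e (here _) ; suffix = q ; splits = refl }

SplitAtLevel : {x y : BV d} → Path x y → ℕ → Set
SplitAtLevel {d} p l = Σ[ a ∈ BV d ] level a ≡ l × Split p a

-- A path flipping bit i uses an edge between levels i and i + 1, so it visits both levels.
bit-flip⇒visits : {x y : BV d} (p : Path x y) (i : Fin d) → bit x i ≢ bit y i →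
                  SplitAtLevel p (toℕ i) × SplitAtLevel p (suc (toℕ i))
bit-flip⇒visits (here _) i flips = contradiction refl flips
bit-flip⇒visits {x = x} (step {y = x′} e q) i flips with bit x i ≟ᵇ bit x′ i
... | yes same = let (low , high) = bit-flip⇒visits q i (flips ∘ trans same) in prepend low , prepend high
  where
  prepend : ∀ {l} → SplitAtLevel q l → SplitAtLevel (step e q) l
  prepend (a , la , s) = a , la , Split-step e s
... | no flipped with adjacent-ascent e
...   | inj₁ x↗x′ = (x  , sym i≡x  , Split-start (step e q)) ,
                    (x′ , trans (level-suc x↗x′) (cong suc (sym i≡x)) , Split-second e q)
  where i≡x = ascent-flips-at-level x↗x′ flipped
...   | inj₂ x′↗x = (x′ , sym i≡x′ , Split-second e q) ,
                    (x  , trans (level-suc x′↗x) (cong suc (sym i≡x′)) , Split-start (step e q))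
  where i≡x′ = ascent-flips-at-level x′↗x (flipped ∘ sym)

bit-flip⇒len-≥-above : {x y : BV d} (p : Path x y) (i : Fin d) → bit x i ≢ bit y i →
                       suc (toℕ i) + suc (toℕ i) ≤ len p + (level x + level y)
bit-flip⇒len-≥-above {x = x} {y} p i flips with b , b≡i+1 , s ← proj₂ (bit-flip⇒visits p i flips) = begin
  suc (toℕ i) + suc (toℕ i)                    ≡⟨ cong₂ _+_ b≡i+1 b≡i+1 ⟨
  level b + level b                            ≤⟨ +-mono-≤ (level-≤-len (prefix s)) (level-≤-len′ (suffix s)) ⟩
  (len (prefix s) + level x) + (len (suffix s) + level y)
                                               ≡⟨ interchange (len (prefix s)) (level x) (len (suffix s)) (level y) ⟩
  (len (prefix s) + len (suffix s)) + (level x + level y)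
                                               ≡⟨ cong (_+ (level x + level y)) (len-split s) ⟩
  len p + (level x + level y)                  ∎
  where open ≤-Reasoning

bit-flip⇒len-≥-below : {x y : BV d} (p : Path x y) (i : Fin d) → bit x i ≢ bit y i →
                       level x + level y ≤ len p + (toℕ i + toℕ i)
bit-flip⇒len-≥-below {x = x} {y} p i flips with a , a≡i , s ← proj₁ (bit-flip⇒visits p i flips) = begin
  level x + level y                            ≤⟨ +-mono-≤ (level-≤-len′ (prefix s)) (level-≤-len (suffix s)) ⟩
  (len (prefix s) + level a) + (len (suffix s) + level a)
                                               ≡⟨ interchange (len (prefix s)) (level a) (len (suffix s)) (level a) ⟩
  (len (prefix s) + len (suffix s)) + (level a + level a)
                                               ≡⟨ cong₂ (λ n l → n + (l + l)) (len-split s) a≡i ⟩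
  len p + (toℕ i + toℕ i)                      ∎
  where open ≤-Reasoning

-- u ≼ w: w is reached from u by going straight up, i.e. only the bits with index in
-- [level u, level w) may differ.
record _≼_ {d} (u w : BV d) : Set where
  field
    level-≤     : level u ≤ level w
    agree-below : ∀ i → toℕ i < level u → bit u i ≡ bit w i
    agree-above : ∀ i → level w ≤ toℕ i → bit u i ≡ bit w i

open _≼_

_≺_ : BV d → BV d → Set
u ≺ w = u ≼ w × u ≢ w

≼-refl : {u : BV d} → u ≼ u
≼-refl = record { level-≤ = ≤-refl ; agree-below = λ _ _ → refl ; agree-above = λ _ _ → refl }

≼-trans : {t u w : BV d} → t ≼ u → u ≼ w → t ≼ w
≼-trans t≼u u≼w = record
  { level-≤     = ≤-trans (level-≤ t≼u) (level-≤ u≼w)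
  ; agree-below = λ i i<t → trans (agree-below t≼u i i<t) (agree-below u≼w i (≤-trans i<t (level-≤ t≼u)))
  ; agree-above = λ i w≤i → trans (agree-above t≼u i (≤-trans (level-≤ u≼w) w≤i)) (agree-above u≼w i w≤i)
  }

≼∧level-≡⇒≡ : {u w : BV d} → u ≼ w → level u ≡ level w → u ≡ w
≼∧level-≡⇒≡ {u = u} {w} u≼w u≡w = vertex-ext u≡w bits
  where
  bits : ∀ i → bit u i ≡ bit w i
  bits i with ≤-<-connex (level u) (toℕ i)
  ... | inj₁ u≤i = agree-above u≼w i (subst (_≤ toℕ i) u≡w u≤i)
  ... | inj₂ i<u = agree-below u≼w i i<u

≺⇒level-< : {u w : BV d} → u ≺ w → level u < level w
≺⇒level-< (u≼w , u≢w) = ≤∧≢⇒< (level-≤ u≼w) (u≢w ∘ ≼∧level-≡⇒≡ u≼w)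

ascent⇒≼ : {u v : BV d} → Ascent u v → u ≼ v
ascent⇒≼ {u = u} u↗v = record
  { level-≤     = ≤-trans (n≤1+n _) (≤-reflexive (sym (level-suc u↗v)))
  ; agree-below = λ i i<u → sym (bit-fixed u↗v i (<⇒≢ i<u))
  ; agree-above = λ i v≤i → sym (bit-fixed u↗v i (λ i≡u → <-irrefl (sym i≡u)
                    (≤-trans (≤-reflexive (sym (level-suc u↗v))) v≤i)))
  }

same-column⇒≼ : {u w : BV d} → column u ≡ column w → level u ≤ level w → u ≼ w
same-column⇒≼ same u≤w = record
  { level-≤     = u≤w
  ; agree-below = λ i _ → cong (λ c → lookup c i) same
  ; agree-above = λ i _ → cong (λ c → lookup c i) same
  }

_≼?_ : (u w : BV d) → Dec (u ≼ w)
u ≼? w = map′ (λ (l , b , a) → record { level-≤ = l ; agree-below = b ; agree-above = a })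
              (λ u≼w → level-≤ u≼w , agree-below u≼w , agree-above u≼w)
              (level u ≤? level w
                ×-dec all? (λ i → toℕ i <? level u →-dec bit u i ≟ᵇ bit w i)
                ×-dec all? (λ i → level w ≤? toℕ i →-dec bit u i ≟ᵇ bit w i))

_≟ᵛ_ : (u w : BV d) → Dec (u ≡ w)
_≟ᵛ_ = ×-≡-dec _≟ᶠ_ (≡-dec _≟ᵇ_)

_≺?_ : (u w : BV d) → Dec (u ≺ w)
u ≺? w = u ≼? w ×-dec ¬? (u ≟ᵛ w)

splice : ℕ → Vec Bool d → Vec Bool d → Vec Bool d
splice l z c = tabulate λ i → if does (toℕ i <? l) then lookup z i else lookup c i

lookup-splice-< : ∀ {l} (z c : Vec Bool d) {i} → toℕ i < l → lookup (splice l z c) i ≡ lookup z i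
lookup-splice-< {l = l} z c {i} i<l =
  trans (lookup∘tabulate _ i) (cong (if_then lookup z i else lookup c i) (dec-true (toℕ i <? l) i<l))

lookup-splice-≥ : ∀ {l} (z c : Vec Bool d) {i} → l ≤ toℕ i → lookup (splice l z c) i ≡ lookup c i
lookup-splice-≥ {l = l} z c {i} l≤i =
  trans (lookup∘tabulate _ i) (cong (if_then lookup z i else lookup c i) (dec-false (toℕ i <? l) (≤⇒≯ l≤i)))

Between : ℕ → ℕ → BV d → Set
Between lo hi v = lo < level v × level v < hi

InnerBetween : {x y : BV d} → Path x y → ℕ → ℕ → Set
InnerBetween p lo hi = ∀ {v} → v ∈ inner p → Between lo hi v

step-toward : {u w : BV d} → u ≼ w → level u < level w → Σ[ u′ ∈ BV d ] BEdge u u′ × u′ ≼ w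
step-toward {u = u} {w} u≼w u<w with u′ , edge , copies ← edge-up-copying-bit u (<-≤-trans u<w (level≤d w)) (column w)
  = u′ , edge , record
    { level-≤     = ≤-trans (≤-reflexive (level-suc u↗u′)) u<w
    ; agree-below = below
    ; agree-above = λ i w≤i → trans (bit-fixed u↗u′ i (λ i≡u → <-irrefl (sym i≡u) (<-≤-trans u<w w≤i)))
                                    (agree-above u≼w i w≤i)
    }
  where
  u↗u′ = edge-ascent edge
  below : ∀ i → toℕ i < level u′ → bit u′ i ≡ bit w i
  below i i<u′ with toℕ i ≟ level u
  ... | yes i≡u = copies i i≡u
  ... | no  i≢u = trans (bit-fixed u↗u′ i i≢u)
                    (agree-below u≼w i (≤∧≢⇒< (s≤s⁻¹ (≤-trans i<u′ (≤-reflexive (level-suc u↗u′)))) i≢u))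

inner-between-step : {u u′ w : BV d} (e : BAdj d u u′) (q : Path u′ w) → Ascent u u′ → len q + level u′ ≡ level w →
                     InnerBetween q (level u′) (level w) → InnerBetween (step e q) (level u) (level w)
inner-between-step e q u↗u′ len≡ between m with ∈-internal-step⁻ e q m
... | inj₁ (refl , 0<q) = ≤-reflexive (sym (level-suc u↗u′)) , ≤-trans (+-monoˡ-≤ _ 0<q) (≤-reflexive len≡)
... | inj₂ m′           = let (u′<v , v<w) = between m′ in <-trans (≤-reflexive (sym (level-suc u↗u′))) u′<v , v<w

ascending-path-of-length : ∀ n {u w : BV d} → n + level u ≡ level w → u ≼ w →
                           Σ[ p ∈ Path u w ] len p ≡ n × InnerBetween p (level u) (level w)
ascending-path-of-length zero     u≡w u≼w with refl ← ≼∧level-≡⇒≡ u≼w u≡w = here _ , refl , λ ()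
ascending-path-of-length (suc n) {u} {w} 1+n+u≡w u≼w =
  let (u′ , edge , u′≼w) = step-toward u≼w (≤-trans (s≤s (m≤n+m (level u) n)) (≤-reflexive 1+n+u≡w))
      u↗u′    = edge-ascent edge
      n+u′≡w  = trans (cong (n +_) (level-suc u↗u′)) (trans (+-suc n (level u)) 1+n+u≡w)
      (q , len-q , q-between) = ascending-path-of-length n n+u′≡w u′≼w
  in step (inj₁ edge) q , cong suc len-q ,
     inner-between-step (inj₁ edge) q u↗u′ (trans (cong (_+ level u′) len-q) n+u′≡w) q-between

ascending-path : {u w : BV d} → u ≼ w →
                 Σ[ p ∈ Path u w ] len p ≡ level w ∸ level u × InnerBetween p (level u) (level w)
ascending-path u≼w = ascending-path-of-length _ (m∸n+n≡m (level-≤ u≼w)) u≼w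

Tight : {x y : BV d} → Path x y → Set
Tight {x = x} {y} p = len p + level x ≤ level y

tight-step : {x x′ y : BV d} (e : BAdj d x x′) (q : Path x′ y) → Tight (step e q) → Ascent x x′ × Tight q
tight-step {x = x} {x′} {y} e q tight with adjacent-ascent e
... | inj₁ x↗x′ = x↗x′ , ≤-trans (≤-reflexive (trans (cong (len q +_) (level-suc x↗x′)) (+-suc (len q) (level x))))
                                 tight
... | inj₂ x′↗x = contradiction tight (<⇒≱ (s≤s (≤-trans (level-≤-len q) (+-monoʳ-≤ (len q) x′≤x))))
  where
  x′≤x : level x′ ≤ level x
  x′≤x = ≤-trans (n≤1+n _) (≤-reflexive (sym (level-suc x′↗x)))

tight⇒≼ : {x y : BV d} (p : Path x y) → Tight p → x ≼ y
tight⇒≼ (here _)   _     = ≼-refl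
tight⇒≼ (step e q) tight = let (x↗x′ , tight-q) = tight-step e q tight
                           in ≼-trans (ascent⇒≼ x↗x′) (tight⇒≼ q tight-q)

ascent-≼-between : {x x′ v y : BV d} → Ascent x x′ → x′ ≼ y → x ≼ v → v ≼ y → level x < level v → x′ ≼ v
ascent-≼-between {x = x} {x′} {v} {y} x↗x′ x′≼y x≼v v≼y x<v = record
  { level-≤     = ≤-trans (≤-reflexive (level-suc x↗x′)) x<v
  ; agree-below = below
  ; agree-above = λ i v≤i → trans (bit-fixed x↗x′ i (λ i≡x → <-irrefl (sym i≡x) (<-≤-trans x<v v≤i)))
                                  (agree-above x≼v i v≤i)
  }
  where
  below : ∀ i → toℕ i < level x′ → bit x′ i ≡ bit v i
  below i i<x′ with toℕ i ≟ level x
  ... | yes i≡x = trans (agree-below x′≼y i i<x′) (sym (agree-below v≼y i (≤-<-trans (≤-reflexive i≡x) x<v)))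
  ... | no  i≢x = trans (bit-fixed x↗x′ i i≢x)
                    (agree-below x≼v i (≤∧≢⇒< (s≤s⁻¹ (≤-trans i<x′ (≤-reflexive (level-suc x↗x′)))) i≢x))

-- A tight path climbs straight from x to y, so it must pass through every vertex between them.
tight-passes : {x v y : BV d} (p : Path x y) → Tight p → x ≼ v → v ≼ y →
               level x < level v → level v < level y → v ∈ inner p
tight-passes (here _) _ _ _ x<v v<x = contradiction (<-trans x<v v<x) (<-irrefl refl)
tight-passes {x = x} {v} (step {y = x′} e q) tight x≼v v≼y x<v v<y with tight-step e q tight
... | x↗x′ , tight-q = via (ascent-≼-between x↗x′ (tight⇒≼ q tight-q) x≼v v≼y x<v)
  where
  via : x′ ≼ v → v ∈ inner (step e q)
  via x′≼v with level x′ ≟ level v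
  ... | yes x′≡v with refl ← ≼∧level-≡⇒≡ x′≼v x′≡v =
    start-∈-internal-step e q (≢⇒0<wlen q (λ x′≡y → <-irrefl (cong level x′≡y) v<y))
  ... | no  x′≢v =
    ∈-internal-step⁺ e q (tight-passes q tight-q x′≼v v≼y (≤∧≢⇒< (level-≤ x′≼v) x′≢v) v<y)

shortest⇒tight : {u w : BV d} → u ≼ w → (p : Path u w) → IsShortest (BAdj d) p → Tight p
shortest⇒tight {u = u} {w} u≼w p shortest = let (q , len-q , _) = ascending-path u≼w in begin
  len p + level u             ≤⟨ +-monoˡ-≤ (level u) (shortest q) ⟩
  len q + level u             ≡⟨ cong (_+ level u) len-q ⟩
  (level w ∸ level u) + level u ≡⟨ m∸n+n≡m (level-≤ u≼w) ⟩
  level w                     ∎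
  where open ≤-Reasoning

peak-path : {x y m : BV d} → x ≼ m → y ≼ m →
            Σ[ p ∈ Path x y ] len p ≡ (level m ∸ level x) + (level m ∸ level y) ×
              (∀ {v} → v ∈ inner p → Between (level x) (level m) v ⊎ v ≡ m ⊎ Between (level y) (level m) v)
peak-path x≼m y≼m =
  let (up , len-up , up-between)       = ascending-path x≼m
      (down , len-down , down-between) = ascending-path y≼m
      down⁻¹ = reverse BAdj-sym down
  in up ++ʷ down⁻¹ ,
     trans (wlen-++ up down⁻¹) (cong₂ _+_ len-up (trans (wlen-reverse BAdj-sym down) len-down)) ,
     λ m → Sum.map up-between (Sum.map₂ (down-between ∘ ∈-internal-reverse⁻ BAdj-sym down))
                                   (∈-internal-++⁻ up down⁻¹ m)

valley-path : {x y m : BV d} → m ≼ x → m ≼ y →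
              Σ[ p ∈ Path x y ] len p ≡ (level x ∸ level m) + (level y ∸ level m) ×
                (∀ {v} → v ∈ inner p → Between (level m) (level x) v ⊎ v ≡ m ⊎ Between (level m) (level y) v)
valley-path m≼x m≼y =
  let (down , len-down , down-between) = ascending-path m≼x
      (up , len-up , up-between)       = ascending-path m≼y
      down⁻¹ = reverse BAdj-sym down
  in down⁻¹ ++ʷ up ,
     trans (wlen-++ down⁻¹ up) (cong₂ _+_ (trans (wlen-reverse BAdj-sym down) len-down) len-up) ,
     λ m → Sum.map (down-between ∘ ∈-internal-reverse⁻ BAdj-sym down) (Sum.map₂ up-between)
                        (∈-internal-++⁻ down⁻¹ up m)

record CrossingAbove {d} {x y : BV d} (p : Path x y) (l : ℕ) : Set where
  field
    apex         : BV d
    x≼apex       : x ≼ apex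
    level-apex   : level apex ≡ l
    passes-below : ∀ {v} → x ≼ v → v ≼ apex → level x < level v → v ∈ inner p

record CrossingBelow {d} {x y : BV d} (p : Path x y) (l : ℕ) : Set where
  field
    nadir        : BV d
    nadir≼x      : nadir ≼ x
    level-nadir  : level nadir ≡ l
    passes-above : ∀ {v} → nadir ≼ v → v ≼ x → level v < level x → v ∈ inner p

-- If p flips bit k and is no longer than the detour over level k + 1, its part up to that
-- level is tight, so p passes through every vertex between x and the vertex where it arrives.
crossing-above : {x y : BV d} (p : Path x y) (k : Fin d) → bit x k ≢ bit y k → level y ≤ toℕ k →
                 len p + (level x + level y) ≤ suc (toℕ k) + suc (toℕ k) → CrossingAbove p (suc (toℕ k))
crossing-above {x = x} {y} p k flips y≤k short with a , a≡k+1 , s ← proj₂ (bit-flip⇒visits p k flips)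
  = record { apex = a ; x≼apex = tight⇒≼ (prefix s) tight-prefix ; level-apex = a≡k+1 ; passes-below = passes }
  where
  tight-prefix : Tight (prefix s)
  tight-prefix = +-cancelʳ-≤ (level a) _ _ (begin
    len (prefix s) + level x + level a            ≤⟨ +-monoʳ-≤ _ (level-≤-len′ (suffix s)) ⟩
    (len (prefix s) + level x) + (len (suffix s) + level y)
                                                  ≡⟨ interchange (len (prefix s)) (level x) (len (suffix s)) (level y) ⟩
    (len (prefix s) + len (suffix s)) + (level x + level y)
                                                  ≡⟨ cong (_+ (level x + level y)) (len-split s) ⟩
    len p + (level x + level y)                   ≤⟨ short ⟩
    suc (toℕ k) + suc (toℕ k)                     ≡⟨ cong₂ _+_ a≡k+1 a≡k+1 ⟨
    level a + level a                             ∎)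
    where open ≤-Reasoning
  passes : ∀ {v} → x ≼ v → v ≼ a → level x < level v → v ∈ inner p
  passes {v} x≼v v≼a x<v with level v <? level a
  ... | yes v<a = prefix-inner⊆ s (tight-passes (prefix s) tight-prefix x≼v v≼a x<v v<a)
  ... | no  v≮a with refl ← ≼∧level-≡⇒≡ v≼a (≤-antisym (level-≤ v≼a) (≮⇒≥ v≮a)) =
    junction-∈-inner s (≢⇒0<wlen (prefix s) (λ x≡a → <-irrefl (cong level x≡a) x<v))
              (≢⇒0<wlen (suffix s) (λ a≡y → <-irrefl (cong level (sym a≡y))
                                              (≤-<-trans y≤k (≤-reflexive (sym a≡k+1)))))

crossing-below : {x y : BV d} (p : Path x y) (k : Fin d) → bit x k ≢ bit y k → toℕ k < level y →
                 len p + (toℕ k + toℕ k) ≤ level x + level y → CrossingBelow p (toℕ k)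
crossing-below {x = x} {y} p k flips k<y short with a , a≡k , s ← proj₁ (bit-flip⇒visits p k flips)
  = record { nadir = a ; nadir≼x = tight⇒≼ prefix⁻¹ tight-prefix⁻¹ ; level-nadir = a≡k ; passes-above = passes }
  where
  prefix⁻¹ = reverse BAdj-sym (prefix s)
  tight-prefix⁻¹ : Tight prefix⁻¹
  tight-prefix⁻¹ = subst (λ n → n + level a ≤ level x) (sym (wlen-reverse BAdj-sym (prefix s)))
    (+-cancelʳ-≤ (len (suffix s) + level a) _ _ (begin
      (len (prefix s) + level a) + (len (suffix s) + level a)
                                                  ≡⟨ interchange (len (prefix s)) (level a) (len (suffix s)) (level a) ⟩
      (len (prefix s) + len (suffix s)) + (level a + level a)
                                                  ≡⟨ cong₂ (λ n l → n + (l + l)) (len-split s) a≡k ⟩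
      len p + (toℕ k + toℕ k)                     ≤⟨ short ⟩
      level x + level y                           ≤⟨ +-monoʳ-≤ (level x) (level-≤-len (suffix s)) ⟩
      level x + (len (suffix s) + level a)        ∎))
    where open ≤-Reasoning
  passes : ∀ {v} → a ≼ v → v ≼ x → level v < level x → v ∈ inner p
  passes {v} a≼v v≼x v<x with level a <? level v
  ... | yes a<v = prefix-inner⊆ s (∈-internal-reverse⁻ BAdj-sym (prefix s)
                    (tight-passes prefix⁻¹ tight-prefix⁻¹ a≼v v≼x a<v v<x))
  ... | no  a≮v with refl ← ≼∧level-≡⇒≡ a≼v (≤-antisym (level-≤ a≼v) (≮⇒≥ a≮v)) =
    junction-∈-inner s (≢⇒0<wlen (prefix s) (λ x≡a → <-irrefl (cong level (sym x≡a)) v<x))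
              (≢⇒0<wlen (suffix s) (λ a≡y → <-irrefl (trans (sym a≡k) (cong level a≡y)) k<y))

[t∸a]+[t∸b]+[a+b]≡t+t : ∀ {a b t} → a ≤ t → b ≤ t → (t ∸ a) + (t ∸ b) + (a + b) ≡ t + t
[t∸a]+[t∸b]+[a+b]≡t+t {a} {b} {t} a≤t b≤t =
  trans (interchange (t ∸ a) (t ∸ b) a b) (cong₂ _+_ (m∸n+n≡m a≤t) (m∸n+n≡m b≤t))

2^suc≡2^+2^ : ∀ n → 2 ^ suc n ≡ 2 ^ n + 2 ^ n
2^suc≡2^+2^ n = cong (2 ^ n +_) (+-identityʳ (2 ^ n))

2^[n+1]≡2^+2^ : ∀ n → 2 ^ (n + 1) ≡ 2 ^ n + 2 ^ n
2^[n+1]≡2^+2^ n = trans (cong (2 ^_) (+-comm n 1)) (2^suc≡2^+2^ n)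

columns : ∀ d → List (Vec Bool d)
columns zero    = [] ∷ []
columns (suc d) = map (true ∷_) (columns d) ++ map (false ∷_) (columns d)

∈-columns : (c : Vec Bool d) → c ∈ columns d
∈-columns []                  = here refl
∈-columns {suc d} (true ∷ c)  = ∈-++⁺ˡ (∈-map⁺ (true ∷_) (∈-columns c))
∈-columns {suc d} (false ∷ c) = ∈-++⁺ʳ (map (true ∷_) (columns d)) (∈-map⁺ (false ∷_) (∈-columns c))

length-columns : ∀ d → length (columns d) ≡ 2 ^ d
length-columns zero    = refl
length-columns (suc d) = begin
  length (map (true ∷_) (columns d) ++ map (false ∷_) (columns d))
    ≡⟨ length-++ (map (true ∷_) (columns d)) ⟩
  length (map (true ∷_) (columns d)) + length (map (false ∷_) (columns d))
    ≡⟨ cong₂ _+_ (length-map (true ∷_) (columns d)) (length-map (false ∷_) (columns d)) ⟩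
  length (columns d) + length (columns d)
    ≡⟨ cong₂ _+_ (length-columns d) (length-columns d) ⟩
  2 ^ d + 2 ^ d
    ≡⟨ 2^suc≡2^+2^ d ⟨
  2 ^ suc d
    ∎
  where open ≡-Reasoning

∷-injectiveʳ : ∀ {b} {c c′ : Vec Bool d} → b ∷ c ≡ b ∷ c′ → c ≡ c′
∷-injectiveʳ refl = refl

true-false-disjoint : (cs cs′ : List (Vec Bool d)) {c : Vec Bool (suc d)} →
                      c ∈ map (true ∷_) cs × c ∈ map (false ∷_) cs′ → ⊥
true-false-disjoint cs cs′ (m , m′) with _ , _ , refl ← ∈-map⁻ (true ∷_) m | _ , _ , () ← ∈-map⁻ (false ∷_) m′

columns-unique : ∀ d → Unique (columns d)
columns-unique zero    = All.[] ∷ []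
columns-unique (suc d) = ++⁺ (map⁺ ∷-injectiveʳ (columns-unique d)) (map⁺ ∷-injectiveʳ (columns-unique d))
                             (true-false-disjoint (columns d) (columns d))

all-false : ∀ d → Vec Bool d
all-false d = replicate d false

nonzero-columns : ∀ d → List (Vec Bool d)
nonzero-columns zero    = []
nonzero-columns (suc d) = map (true ∷_) (columns d) ++ map (false ∷_) (nonzero-columns d)

∈-nonzero-columns⁻ : {c : Vec Bool d} → c ∈ nonzero-columns d → c ≢ all-false d
∈-nonzero-columns⁻ {suc d} m with ∈-++⁻ (map (true ∷_) (columns d)) m
... | inj₁ m′ with _ , _ , refl ← ∈-map⁻ (true ∷_) m′ = λ ()
... | inj₂ m′ with _ , c∈ , refl ← ∈-map⁻ (false ∷_) m′ = ∈-nonzero-columns⁻ c∈ ∘ ∷-injectiveʳ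

nonzero-columns-unique : ∀ d → Unique (nonzero-columns d)
nonzero-columns-unique zero    = []
nonzero-columns-unique (suc d) =
  ++⁺ (map⁺ ∷-injectiveʳ (columns-unique d)) (map⁺ ∷-injectiveʳ (nonzero-columns-unique d))
      (true-false-disjoint (columns d) (nonzero-columns d))

length-nonzero-columns : ∀ d → length (nonzero-columns d) + 1 ≡ 2 ^ d
length-nonzero-columns zero    = refl
length-nonzero-columns (suc d) = begin
  length (map (true ∷_) (columns d) ++ map (false ∷_) (nonzero-columns d)) + 1
    ≡⟨ cong (_+ 1) (length-++ (map (true ∷_) (columns d))) ⟩
  length (map (true ∷_) (columns d)) + length (map (false ∷_) (nonzero-columns d)) + 1
    ≡⟨ cong₂ (λ a b → a + b + 1) (length-map (true ∷_) (columns d)) (length-map (false ∷_) (nonzero-columns d)) ⟩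
  length (columns d) + length (nonzero-columns d) + 1
    ≡⟨ +-assoc (length (columns d)) _ 1 ⟩
  length (columns d) + (length (nonzero-columns d) + 1)
    ≡⟨ cong₂ _+_ (length-columns d) (length-nonzero-columns d) ⟩
  2 ^ d + 2 ^ d
    ≡⟨ 2^suc≡2^+2^ d ⟨
  2 ^ suc d
    ∎
  where open ≡-Reasoning

highest-difference : (c c′ : Vec Bool n) → c ≢ c′ →
                     Σ[ j ∈ Fin n ] lookup c j ≢ lookup c′ j × (∀ i → toℕ j < toℕ i → lookup c i ≡ lookup c′ i)
highest-difference []      []       c≢c′ = contradiction refl c≢c′
highest-difference (a ∷ c) (b ∷ c′) c≢c′ with ≡-dec _≟ᵇ_ c c′
... | yes refl = fzero , (λ a≡b → c≢c′ (cong (_∷ c) a≡b)) , λ { (fsuc i) _ → refl }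
... | no  tails≢ with j , differ , agree ← highest-difference c c′ tails≢ =
  fsuc j , differ , λ { (fsuc i) j<i → agree i (s≤s⁻¹ j<i) }

lowest-difference : (c c′ : Vec Bool n) → c ≢ c′ →
                    Σ[ j ∈ Fin n ] lookup c j ≢ lookup c′ j × (∀ i → toℕ i < toℕ j → lookup c i ≡ lookup c′ i)
lowest-difference []      []       c≢c′ = contradiction refl c≢c′
lowest-difference (a ∷ c) (b ∷ c′) c≢c′ with a ≟ᵇ b
... | no  a≢b  = fzero , a≢b , λ _ ()
... | yes refl with j , differ , agree ← lowest-difference c c′ (c≢c′ ∘ cong (a ∷_)) =
  fsuc j , differ , λ { fzero _ → refl ; (fsuc i) i<j → agree i (s≤s⁻¹ i<j) }

bottom : Vec Bool d → BV d
bottom c = fzero , c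

top : Vec Bool d → BV d
top {d} c = fromℕ d , c

level-top : (c : Vec Bool d) → level (top c) ≡ d
level-top {d} _ = toℕ-fromℕ d

top-above : {v : BV d} {c : Vec Bool d} → (∀ i → toℕ i < level v → bit v i ≡ lookup c i) → v ≼ top c
top-above {v = v} {c} agrees = record
  { level-≤     = ≤-trans (level≤d v) (≤-reflexive (sym (level-top c)))
  ; agree-below = agrees
  ; agree-above = λ i top≤i → contradiction (≤-trans (≤-reflexive (sym (level-top c))) top≤i) (<⇒≱ (toℕ<n i))
  }

bottom-below : {v : BV d} {c : Vec Bool d} → (∀ i → level v ≤ toℕ i → lookup c i ≡ bit v i) → bottom c ≼ v
bottom-below agrees = record { level-≤ = z≤n ; agree-below = λ _ () ; agree-above = agrees }

-- Geodesics between two bottom (top) vertices turn at a vertex whose bits below (from) its level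
-- are all false; on level d (level 0) such a vertex has the all-false column, which is therefore
-- left out.
X₀ : ∀ d → List (BV d)
X₀ d = map bottom (nonzero-columns d) ++ map top (nonzero-columns d)

∈-X₀⁻ : {v : BV d} → v ∈ X₀ d → Σ[ c ∈ Vec Bool d ] c ≢ all-false d × (v ≡ bottom c ⊎ v ≡ top c)
∈-X₀⁻ {d} m with ∈-++⁻ (map bottom (nonzero-columns d)) m
... | inj₁ m′ with c , c∈ , eq ← ∈-map⁻ bottom m′ = c , ∈-nonzero-columns⁻ c∈ , inj₁ eq
... | inj₂ m′ with c , c∈ , eq ← ∈-map⁻ top m′    = c , ∈-nonzero-columns⁻ c∈ , inj₂ eq

∉-X₀-inside : {v : BV d} → 0 < level v → level v < d → v ∉ X₀ d
∉-X₀-inside 0<v v<d m with ∈-X₀⁻ m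
... | _ , _ , inj₁ refl = <-irrefl refl 0<v
... | c , _ , inj₂ refl = <-irrefl (level-top c) v<d

∉-X₀-all-false : {v : BV d} → column v ≡ all-false d → v ∉ X₀ d
∉-X₀-all-false v≡0 m with ∈-X₀⁻ m
... | _ , c≢0 , inj₁ refl = c≢0 v≡0
... | _ , c≢0 , inj₂ refl = c≢0 v≡0

X₀-unique : 1 ≤ d → Unique (X₀ d)
X₀-unique {d} 1≤d = ++⁺ (map⁺ (cong proj₂) (nonzero-columns-unique d)) (map⁺ (cong proj₂) (nonzero-columns-unique d))
                        bottom-top-disjoint
  where
  bottom-top-disjoint : ∀ {v} → v ∈ map bottom (nonzero-columns d) × v ∈ map top (nonzero-columns d) → ⊥
  bottom-top-disjoint (m , m′) with _ , _ , refl ← ∈-map⁻ bottom m | c , _ , eq ← ∈-map⁻ top m′ =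
    <-irrefl (trans (cong level eq) (level-top c)) 1≤d

length-X₀ : ∀ d → length (X₀ d) ≡ 2 ^ (d + 1) ∸ 2
length-X₀ d = begin
  length (map bottom (nonzero-columns d) ++ map top (nonzero-columns d))
    ≡⟨ length-++ (map bottom (nonzero-columns d)) ⟩
  length (map bottom (nonzero-columns d)) + length (map top (nonzero-columns d))
    ≡⟨ cong₂ _+_ (length-map bottom (nonzero-columns d)) (length-map top (nonzero-columns d)) ⟩
  k + k                       ≡⟨ m+n∸n≡m (k + k) 2 ⟨
  (k + k + 2) ∸ 2             ≡⟨ cong (_∸ 2) (rearrange k) ⟩
  ((k + 1) + (k + 1)) ∸ 2     ≡⟨ cong (λ m → (m + m) ∸ 2) (length-nonzero-columns d) ⟩
  (2 ^ d + 2 ^ d) ∸ 2         ≡⟨ cong (_∸ 2) (2^[n+1]≡2^+2^ d) ⟨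
  2 ^ (d + 1) ∸ 2             ∎
  where
  open ≡-Reasoning
  k = length (nonzero-columns d)
  rearrange : ∀ n → n + n + 2 ≡ (n + 1) + (n + 1)
  rearrange = solve-∀

visible-by : {X : List (BV d)} {x y : BV d} (p : Path x y) → IsShortest (BAdj d) p →
             (∀ {v} → v ∈ inner p → v ∉ X) → Visible (BAdj d) X x y
visible-by p shortest avoids = p , shortest , All.tabulate avoids

visible-bottoms : (c c′ : Vec Bool d) → Visible (BAdj d) (X₀ d) (bottom c) (bottom c′)
visible-bottoms c c′ with ≡-dec _≟ᵇ_ c c′
... | yes refl = visible-by (here _) (λ _ → z≤n) λ ()
visible-bottoms {d} c c′ | no c≢c′ with j , differ , agree ← highest-difference c c′ c≢c′ =
  visible-by p shortest avoids
  where
  peak : BV d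
  peak = fsuc j , splice (suc (toℕ j)) (all-false d) c
  path = peak-path (bottom-below λ i j<i → sym (lookup-splice-≥ (all-false d) c j<i))
                    (bottom-below λ i j<i → trans (sym (agree i j<i)) (sym (lookup-splice-≥ (all-false d) c j<i)))
  p = proj₁ path
  shortest : IsShortest (BAdj d) p
  shortest q = begin
    len p                      ≡⟨ proj₁ (proj₂ path) ⟩
    suc (toℕ j) + suc (toℕ j)  ≤⟨ bit-flip⇒len-≥-above q j differ ⟩
    len q + 0                  ≡⟨ +-identityʳ (len q) ⟩
    len q                      ∎
    where open ≤-Reasoning
  peak∉X₀ : peak ∉ X₀ d
  peak∉X₀ with suc (toℕ j) <? d
  ... | yes j+1<d = ∉-X₀-inside (s≤s z≤n) j+1<d
  ... | no  j+1≮d = ∉-X₀-all-false (Vec-ext λ i → lookup-splice-< (all-false d) c (<-≤-trans (toℕ<n i) (≮⇒≥ j+1≮d)))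
  avoids : ∀ {v} → v ∈ inner p → v ∉ X₀ d
  avoids m with proj₂ (proj₂ path) m
  ... | inj₁ (0<v , v<peak)        = ∉-X₀-inside 0<v (<-≤-trans v<peak (level≤d peak))
  ... | inj₂ (inj₁ refl)           = peak∉X₀
  ... | inj₂ (inj₂ (0<v , v<peak)) = ∉-X₀-inside 0<v (<-≤-trans v<peak (level≤d peak))

visible-tops : (c c′ : Vec Bool d) → Visible (BAdj d) (X₀ d) (top c) (top c′)
visible-tops c c′ with ≡-dec _≟ᵇ_ c c′
... | yes refl = visible-by (here _) (λ _ → z≤n) λ ()
visible-tops {d} c c′ | no c≢c′ with j , differ , agree ← lowest-difference c c′ c≢c′ =
  visible-by p shortest avoids
  where
  valley : BV d
  valley = inject₁ j , splice (toℕ (inject₁ j)) c (all-false d)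
  valley≼top : valley ≼ top c
  valley≼top = top-above λ i i<j → lookup-splice-< c (all-false d) i<j
  path = valley-path valley≼top
                     (top-above λ i i<j → trans (lookup-splice-< c (all-false d) i<j)
                                                (agree i (<-≤-trans i<j (≤-reflexive (toℕ-inject₁ j)))))
  p = proj₁ path
  d∸j = toℕ (fromℕ d) ∸ toℕ (inject₁ j)
  shortest : IsShortest (BAdj d) p
  shortest q = +-cancelʳ-≤ (toℕ j + toℕ j) _ _ (begin
    len p + (toℕ j + toℕ j)      ≡⟨ cong₂ (λ n l → n + (l + l)) (proj₁ (proj₂ path)) (sym (toℕ-inject₁ j)) ⟩
    (d∸j + d∸j) + (toℕ (inject₁ j) + toℕ (inject₁ j))
                                 ≡⟨ [t∸a]+[t∸b]+[a+b]≡t+t (level-≤ valley≼top) (level-≤ valley≼top) ⟩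
    toℕ (fromℕ d) + toℕ (fromℕ d) ≤⟨ bit-flip⇒len-≥-below q j differ ⟩
    len q + (toℕ j + toℕ j)      ∎)
    where open ≤-Reasoning
  valley∉X₀ : valley ∉ X₀ d
  valley∉X₀ with level valley ≟ 0
  ... | yes j≡0 = ∉-X₀-all-false (Vec-ext λ i → lookup-splice-≥ c (all-false d) (≤-trans (≤-reflexive j≡0) z≤n))
  ... | no  j≢0 = ∉-X₀-inside (n≢0⇒n>0 j≢0) (≤-<-trans (≤-reflexive (toℕ-inject₁ j)) (toℕ<n j))
  avoids : ∀ {v} → v ∈ inner p → v ∉ X₀ d
  avoids m with proj₂ (proj₂ path) m
  ... | inj₁ (j<v , v<d)        = ∉-X₀-inside (≤-<-trans z≤n j<v) (<-≤-trans v<d (≤-reflexive (level-top c)))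
  ... | inj₂ (inj₁ refl)        = valley∉X₀
  ... | inj₂ (inj₂ (j<v , v<d)) = ∉-X₀-inside (≤-<-trans z≤n j<v) (<-≤-trans v<d (≤-reflexive (level-top c′)))

visible-bottom-top : (c c′ : Vec Bool d) → Visible (BAdj d) (X₀ d) (bottom c) (top c′)
visible-bottom-top {d} c c′ = visible-by p shortest avoids
  where
  path = ascending-path (top-above {c = c′} λ _ ())
  p = proj₁ path
  shortest : IsShortest (BAdj d) p
  shortest q = ≤-trans (≤-reflexive (proj₁ (proj₂ path)))
                       (≤-trans (level-≤-len q) (≤-reflexive (+-identityʳ (len q))))
  avoids : ∀ {v} → v ∈ inner p → v ∉ X₀ d
  avoids m = let (0<v , v<d) = proj₂ (proj₂ path) m
             in ∉-X₀-inside 0<v (<-≤-trans v<d (≤-reflexive (level-top c′)))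

X₀-mutually-visible : ∀ d → MutualVis (BAdj d) (X₀ d)
X₀-mutually-visible d x∈ y∈ with ∈-X₀⁻ x∈ | ∈-X₀⁻ y∈
... | c , _ , inj₁ refl | c′ , _ , inj₁ refl = visible-bottoms c c′
... | c , _ , inj₁ refl | c′ , _ , inj₂ refl = visible-bottom-top c c′
... | c , _ , inj₂ refl | c′ , _ , inj₁ refl = Visible-sym BAdj-sym (visible-bottom-top c′ c)
... | c , _ , inj₂ refl | c′ , _ , inj₂ refl = visible-tops c c′

Antichain : List (BV d) → Set
Antichain A = ∀ {v w} → v ∈ A → w ∈ A → v ≼ w → v ≡ w

antichain-column-injective : {A : List (BV d)} → Antichain A →
                             ∀ {v w} → v ∈ A → w ∈ A → column v ≡ column w → v ≡ w
antichain-column-injective anti {v} {w} v∈ w∈ same with ≤-total (level v) (level w)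
... | inj₁ v≤w = anti v∈ w∈ (same-column⇒≼ same v≤w)
... | inj₂ w≤v = sym (anti w∈ v∈ (same-column⇒≼ (sym same) w≤v))

length-antichain-≤ : {A : List (BV d)} → Antichain A → Unique A → length A ≤ 2 ^ d
length-antichain-≤ {d} {A} anti unique = begin
  length A                 ≡⟨ length-map column A ⟨
  length (map column A)    ≤⟨ Unique⇒length-≤ (Unique-map column unique (antichain-column-injective anti))
                                              (λ {c} _ → ∈-columns c) ⟩
  length (columns d)       ≡⟨ length-columns d ⟩
  2 ^ d                    ∎
  where open ≤-Reasoning

-- The track of a ≼ b: the straight climb from a to b, extended to all levels.
OnTrack : BV d → BV d → BV d → Set
OnTrack a b v = column v ≡ splice (level v) (column b) (column a)

module _ {a b v : BV d} (a≼b : a ≼ b) (on-track : OnTrack a b v) where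

  private
    bit-below : ∀ i → toℕ i < level v → bit v i ≡ bit b i
    bit-below i i<v = trans (cong (λ c → lookup c i) on-track) (lookup-splice-< (column b) (column a) i<v)

    bit-above : ∀ i → level v ≤ toℕ i → bit v i ≡ bit a i
    bit-above i v≤i = trans (cong (λ c → lookup c i) on-track) (lookup-splice-≥ (column b) (column a) v≤i)

  track-below : level v ≤ level a → v ≼ a
  track-below v≤a = record
    { level-≤     = v≤a
    ; agree-below = λ i i<v → trans (bit-below i i<v) (sym (agree-below a≼b i (<-≤-trans i<v v≤a)))
    ; agree-above = λ i a≤i → bit-above i (≤-trans v≤a a≤i)
    }

  track-between : level a ≤ level v → level v ≤ level b → a ≼ v × v ≼ b
  track-between a≤v v≤b =
    record
      { level-≤     = a≤v
      ; agree-below = λ i i<a → trans (agree-below a≼b i i<a) (sym (bit-below i (<-≤-trans i<a a≤v)))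
      ; agree-above = λ i v≤i → sym (bit-above i v≤i)
      } ,
    record
      { level-≤     = v≤b
      ; agree-below = bit-below
      ; agree-above = λ i b≤i → trans (bit-above i (≤-trans v≤b b≤i)) (agree-above a≼b i b≤i)
      }

  track-above : level b ≤ level v → b ≼ v
  track-above b≤v = record
    { level-≤     = b≤v
    ; agree-below = λ i i<b → sym (bit-below i (<-≤-trans i<b b≤v))
    ; agree-above = λ i v≤i → trans (sym (agree-above a≼b i (≤-trans b≤v v≤i))) (sym (bit-above i v≤i))
    }

xor-cancelʳ : ∀ x y k → x xor k ≡ y xor k → x ≡ y
xor-cancelʳ x y k eq = begin
  x                  ≡⟨ xor-identityʳ x ⟨
  x xor false        ≡⟨ cong (x xor_) (xor-same k) ⟨
  x xor (k xor k)    ≡⟨ xor-assoc x k k ⟨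
  (x xor k) xor k    ≡⟨ cong (_xor k) eq ⟩
  (y xor k) xor k    ≡⟨ xor-assoc y k k ⟩
  y xor (k xor k)    ≡⟨ cong (y xor_) (xor-same k) ⟩
  y xor false        ≡⟨ xor-identityʳ y ⟩
  y                  ∎
  where open ≡-Reasoning

xor-xor≡ʳ⇒≡ : ∀ {x a b} → (x xor b) xor a ≡ a → x ≡ b
xor-xor≡ʳ⇒≡ {x} {a} {b} eq = xor-cancelʳ x b b (xor-cancelʳ (x xor b) (b xor b) a (begin
  (x xor b) xor a  ≡⟨ eq ⟩
  a                ≡⟨ xor-identityˡ a ⟨
  false xor a      ≡⟨ cong (_xor a) (xor-same b) ⟨
  (b xor b) xor a  ∎))
  where open ≡-Reasoning

-- Below its level, the column of v is translated by column a + column b (over 𝔽₂):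
-- this is injective on an antichain and sends exactly the vertices on the track from a to b
-- to column a.
shifted : BV d → BV d → BV d → Vec Bool d
shifted a b v = zipWith _xor_ (zipWith _xor_ (column v) (column b)) (column a)

translate : BV d → BV d → BV d → Vec Bool d
translate a b v = splice (level v) (shifted a b v) (column v)

module _ (a b : BV d) where

  private
    translate-< : ∀ v i → toℕ i < level v → lookup (translate a b v) i ≡ (bit v i xor bit b i) xor bit a i
    translate-< v i i<v = trans (lookup-splice-< (shifted a b v) (column v) i<v)
      (trans (lookup-zipWith _xor_ i (zipWith _xor_ (column v) (column b)) (column a))
             (cong (_xor bit a i) (lookup-zipWith _xor_ i (column v) (column b))))

    translate-≥ : ∀ v i → level v ≤ toℕ i → lookup (translate a b v) i ≡ bit v i
    translate-≥ v i v≤i = lookup-splice-≥ (shifted a b v) (column v) v≤i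

  translate-≼ : ∀ {v w} → level v ≤ level w → translate a b v ≡ translate a b w → v ≼ w
  translate-≼ {v} {w} v≤w same = record
    { level-≤     = v≤w
    ; agree-below = λ i i<v → xor-cancelʳ _ _ (bit b i) (xor-cancelʳ _ _ (bit a i)
        (trans (sym (translate-< v i i<v))
               (trans (cong (λ c → lookup c i) same) (translate-< w i (<-≤-trans i<v v≤w)))))
    ; agree-above = λ i w≤i → trans (sym (translate-≥ v i (≤-trans v≤w w≤i)))
                                    (trans (cong (λ c → lookup c i) same) (translate-≥ w i w≤i))
    }

  translate-injective : {A : List (BV d)} → Antichain A →
                        ∀ {v w} → v ∈ A → w ∈ A → translate a b v ≡ translate a b w → v ≡ w
  translate-injective anti {v} {w} v∈ w∈ same with ≤-total (level v) (level w)
  ... | inj₁ v≤w = anti v∈ w∈ (translate-≼ v≤w same)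
  ... | inj₂ w≤v = sym (anti w∈ v∈ (translate-≼ w≤v (sym same)))

  translate≡column⇒on-track : ∀ {v} → translate a b v ≡ column a → OnTrack a b v
  translate≡column⇒on-track {v} hit = Vec-ext bits
    where
    bits : ∀ i → bit v i ≡ lookup (splice (level v) (column b) (column a)) i
    bits i with ≤-<-connex (level v) (toℕ i)
    ... | inj₁ v≤i = trans (sym (translate-≥ v i v≤i))
                           (trans (cong (λ c → lookup c i) hit) (sym (lookup-splice-≥ (column b) (column a) v≤i)))
    ... | inj₂ i<v = trans (xor-xor≡ʳ⇒≡ (trans (sym (translate-< v i i<v)) (cong (λ c → lookup c i) hit)))
                           (sym (lookup-splice-< (column b) (column a) i<v))

  length-antichain-off-track : {A : List (BV d)} → Antichain A → Unique A →
                               (∀ {v} → v ∈ A → ¬ OnTrack a b v) → length A < 2 ^ d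
  length-antichain-off-track {A} anti unique off = begin-strict
    length A                      ≡⟨ length-map (translate a b) A ⟨
    length (map (translate a b) A) <⟨ Unique⇒length-< (Unique-map (translate a b) unique (translate-injective anti))
                                                      (λ {c} _ → ∈-columns c) (∈-columns (column a)) missed ⟩
    length (columns d)            ≡⟨ length-columns d ⟩
    2 ^ d                         ∎
    where
    open ≤-Reasoning
    missed : column a ∉ map (translate a b) A
    missed m with v , v∈ , hit ← ∈-map⁻ (translate a b) m = off v∈ (translate≡column⇒on-track {v} (sym hit))

Twins : Fin d → BV d → BV d → Set
Twins k u u′ = bit u k ≢ bit u′ k × (∀ i → i ≢ k → bit u i ≡ bit u′ i)

Twins? : (k : Fin d) (u u′ : BV d) → Dec (Twins k u u′)
Twins? k u u′ = ¬? (bit u k ≟ᵇ bit u′ k) ×-dec all? (λ i → ¬? (i ≟ᶠ k) →-dec bit u i ≟ᵇ bit u′ i)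

TwinsIn : Fin d → List (BV d) → Set
TwinsIn {d} k A = Σ[ u ∈ BV d ] Σ[ u′ ∈ BV d ] u ∈ A × u′ ∈ A × Twins k u u′

removeAt-≡⇒lookup-≡ : {c c′ : Vec Bool (suc n)} (k : Fin (suc n)) → removeAt c k ≡ removeAt c′ k →
                      ∀ i → i ≢ k → lookup c i ≡ lookup c′ i
removeAt-≡⇒lookup-≡ {c = c} {c′} k same i i≢k = begin
  lookup c i                                  ≡⟨ removeAt-punchOut c (i≢k ∘ sym) ⟨
  lookup (removeAt c k) (punchOut (i≢k ∘ sym))  ≡⟨ cong (λ r → lookup r (punchOut (i≢k ∘ sym))) same ⟩
  lookup (removeAt c′ k) (punchOut (i≢k ∘ sym)) ≡⟨ removeAt-punchOut c′ (i≢k ∘ sym) ⟩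
  lookup c′ i                                 ∎
  where open ≡-Reasoning

-- Without twins at k, forgetting bit k of the column is injective on an antichain.
twins-or-length-≤ : (k : Fin (suc n)) {A : List (BV (suc n))} → Antichain A → Unique A →
                    TwinsIn k A ⊎ length A ≤ 2 ^ n
twins-or-length-≤ {n} k {A} anti unique with any? (λ u → any? (Twins? k u) A) A
... | yes has = let (u , u∈ , has′) = find has ; (u′ , u′∈ , twins) = find has′
                in inj₁ (u , u′ , u∈ , u′∈ , twins)
... | no  none = inj₂ (begin
  length A                   ≡⟨ length-map forget A ⟨
  length (map forget A)      ≤⟨ Unique⇒length-≤ (Unique-map forget unique forget-injective) (λ {c} _ → ∈-columns c) ⟩
  length (columns n)         ≡⟨ length-columns n ⟩
  2 ^ n                      ∎)
  where
  open ≤-Reasoning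
  forget : BV (suc n) → Vec Bool n
  forget v = removeAt (column v) k
  forget-injective : ∀ {v w} → v ∈ A → w ∈ A → forget v ≡ forget w → v ≡ w
  forget-injective {v} {w} v∈ w∈ same with bit v k ≟ᵇ bit w k
  ... | no  differ =
    contradiction (lose v∈ (lose w∈ (differ , removeAt-≡⇒lookup-≡ {c = column v} {column w} k same))) none
  ... | yes same-k = antichain-column-injective anti v∈ w∈ (Vec-ext bits)
    where
    bits : ∀ i → bit v i ≡ bit w i
    bits i with i ≟ᶠ k
    ... | yes refl = same-k
    ... | no  i≢k  = removeAt-≡⇒lookup-≡ {c = column v} {column w} k same i i≢k

full-part : ∀ {N a b} → N + N ≤ suc (a + b) → a < N → N ≤ b
full-part {N} {b = b} total a<N = +-cancelˡ-≤ N _ _ (≤-trans total (+-monoˡ-≤ b a<N))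

large-part : ∀ {n a b} → 1 ≤ n → 2 ^ suc n + 2 ^ suc n ≤ suc (a + b) → b ≤ 2 ^ suc n → 2 ^ n < a
large-part {n} {a} {b} 1≤n total b≤N = s≤s⁻¹ (begin
  suc (suc (2 ^ n))  ≡⟨ +-comm 2 (2 ^ n) ⟩
  2 ^ n + 2          ≤⟨ +-monoʳ-≤ (2 ^ n) (^-monoʳ-≤ 2 1≤n) ⟩
  2 ^ n + 2 ^ n      ≡⟨ 2^suc≡2^+2^ n ⟨
  2 ^ suc n          ≤⟨ +-cancelʳ-≤ (2 ^ suc n) _ _ (≤-trans total (s≤s (+-monoʳ-≤ a b≤N))) ⟩
  suc a              ∎)
  where open ≤-Reasoning

module UpperBound {n : ℕ} (X : List (BV (suc n))) (X-unique : Unique X)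
                  (X-visible : MutualVis (BAdj (suc n)) X) where

  no-three-chain : ∀ {t v w} → t ∈ X → v ∈ X → w ∈ X → t ≺ v → v ≺ w → ⊥
  no-three-chain t∈ v∈ w∈ t≺v v≺w =
    let (p , shortest , avoids) = X-visible t∈ w∈
        t≼w = ≼-trans (proj₁ t≺v) (proj₁ v≺w)
    in All.lookup avoids (tight-passes p (shortest⇒tight t≼w p shortest) (proj₁ t≺v) (proj₁ v≺w)
                                       (≺⇒level-< t≺v) (≺⇒level-< v≺w)) v∈

  HasBelow : BV (suc n) → Set
  HasBelow v = Any (_≺ v) X

  HasBelow? : Decidable HasBelow
  HasBelow? v = any? (_≺? v) X

  L U : List (BV (suc n))
  L = filter (∁? HasBelow?) X
  U = filter HasBelow? X

  length-U+L : length U + length L ≡ length X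
  length-U+L = length-filter+∁ HasBelow? X

  ∈-L⁻ : ∀ {v} → v ∈ L → v ∈ X × ¬ HasBelow v
  ∈-L⁻ = ∈-filter⁻ (∁? HasBelow?)

  ∈-U⁻ : ∀ {v} → v ∈ U → v ∈ X × HasBelow v
  ∈-U⁻ = ∈-filter⁻ HasBelow?

  L∩U-empty : ∀ {v} → v ∈ L → v ∉ U
  L∩U-empty v∈L v∈U = proj₂ (∈-L⁻ v∈L) (proj₂ (∈-U⁻ v∈U))

  L-minimal : ∀ {v w} → v ∈ L → w ∈ X → w ≼ v → w ≡ v
  L-minimal {v} {w} v∈L w∈X w≼v with w ≟ᵛ v
  ... | yes w≡v = w≡v
  ... | no  w≢v = contradiction (lose w∈X (w≼v , w≢v)) (proj₂ (∈-L⁻ v∈L))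

  L-antichain : Antichain L
  L-antichain v∈L w∈L v≼w = L-minimal w∈L (proj₁ (∈-L⁻ v∈L)) v≼w

  U-antichain : Antichain U
  U-antichain {v} {w} v∈U w∈U v≼w with v ≟ᵛ w
  ... | yes v≡w = v≡w
  ... | no  v≢w = let (t , t∈X , t≺v) = find (proj₂ (∈-U⁻ v∈U))
                  in ⊥-elim (no-three-chain t∈X (proj₁ (∈-U⁻ v∈U)) (proj₁ (∈-U⁻ w∈U)) t≺v (v≼w , v≢w))

  U-off-bottom : ∀ {v} → v ∈ U → 0 < level v
  U-off-bottom v∈U = let (_ , _ , t≺v) = find (proj₂ (∈-U⁻ v∈U)) in <-≤-trans (s≤s z≤n) (≺⇒level-< t≺v)

  L-unique : Unique L
  L-unique = filter⁺ (∁? HasBelow?) X-unique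

  U-unique : Unique U
  U-unique = filter⁺ HasBelow? X-unique

  L-at-top⇒U-small : ∀ {v} → v ∈ L → level v ≡ suc n → length U < 2 ^ suc n
  L-at-top⇒U-small {v} v∈L v-top = length-antichain-off-track v v U-antichain U-unique off-track
    where
    off-track : ∀ {w} → w ∈ U → ¬ OnTrack v v w
    off-track {w} w∈U on-track
      with refl ← L-minimal v∈L (proj₁ (∈-U⁻ w∈U))
                            (track-below ≼-refl on-track (≤-trans (level≤d w) (≤-reflexive (sym v-top))))
      = L∩U-empty v∈L w∈U

  -- Twins u, u′ at the last bit are joined over the top level; a geodesic must follow a whole
  -- track from u, and none of its vertices can lie in U.
  L-twins⇒U-small : ∀ {u u′} → u ∈ L → u′ ∈ L → Twins (fromℕ n) u u′ → level u ≤ n → level u′ ≤ n →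
                    length U < 2 ^ suc n
  L-twins⇒U-small {u} {u′} u∈L u′∈L (differ , agree) u≤n u′≤n =
    length-antichain-off-track u apex U-antichain U-unique off-track
    where
    k = fromℕ n
    k≡n = toℕ-fromℕ n
    visible = X-visible (proj₁ (∈-L⁻ u∈L)) (proj₁ (∈-L⁻ u′∈L))
    p = proj₁ visible
    u≼T = top-above {c = column u} λ _ _ → refl
    u′≼T = top-above λ i i<u′ → sym (agree i λ { refl → <-irrefl k≡n (<-≤-trans i<u′ u′≤n) })
    detour = peak-path u≼T u′≼T
    short : len p + (level u + level u′) ≤ suc (toℕ k) + suc (toℕ k)
    short = begin
      len p + (level u + level u′)               ≤⟨ +-monoˡ-≤ _ (proj₁ (proj₂ visible) (proj₁ detour)) ⟩
      len (proj₁ detour) + (level u + level u′)  ≡⟨ cong (_+ (level u + level u′)) (proj₁ (proj₂ detour)) ⟩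
      ((T ∸ level u) + (T ∸ level u′)) + (level u + level u′)
                                                 ≡⟨ [t∸a]+[t∸b]+[a+b]≡t+t (level-≤ u≼T) (level-≤ u′≼T) ⟩
      T + T                                      ≡⟨ cong (λ t → t + t) (trans (level-top (column u)) (cong suc (sym k≡n))) ⟩
      suc (toℕ k) + suc (toℕ k)                  ∎
      where
      open ≤-Reasoning
      T = level (top (column u))
    open CrossingAbove (crossing-above p k differ (≤-trans u′≤n (≤-reflexive (sym k≡n))) short)
    off-track : ∀ {w} → w ∈ U → ¬ OnTrack u apex w
    off-track {w} w∈U on-track with level w ≤? level u
    ... | yes w≤u with refl ← L-minimal u∈L (proj₁ (∈-U⁻ w∈U)) (track-below x≼apex on-track w≤u) =
      L∩U-empty u∈L w∈U
    ... | no  w≰u =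
      let w≤apex = ≤-trans (level≤d w) (≤-reflexive (sym (trans level-apex (cong suc k≡n))))
          (u≼w , w≼apex) = track-between x≼apex on-track (≰⇒≥ w≰u) w≤apex
      in All.lookup (proj₂ (proj₂ visible)) (passes-below u≼w w≼apex (≰⇒> w≰u)) (proj₁ (∈-U⁻ w∈U))

  U-twins⇒L-small : ∀ {w w′} → w ∈ U → w′ ∈ U → Twins fzero w w′ → length L < 2 ^ suc n
  U-twins⇒L-small {w} {w′} w∈U w′∈U (differ , agree) =
    length-antichain-off-track nadir w L-antichain L-unique off-track
    where
    visible = X-visible (proj₁ (∈-U⁻ w∈U)) (proj₁ (∈-U⁻ w′∈U))
    p = proj₁ visible
    detour = valley-path (bottom-below {c = column w} λ _ _ → refl)
                         (bottom-below λ i w′≤i → agree i λ { refl → <⇒≱ (U-off-bottom w′∈U) w′≤i })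
    short : len p + 0 ≤ level w + level w′
    short = ≤-trans (≤-reflexive (+-identityʳ (len p)))
                    (≤-trans (proj₁ (proj₂ visible) (proj₁ detour)) (≤-reflexive (proj₁ (proj₂ detour))))
    open CrossingBelow (crossing-below p fzero differ (U-off-bottom w′∈U) short)
    off-track : ∀ {v} → v ∈ L → ¬ OnTrack nadir w v
    off-track {v} v∈L on-track with level v <? level w
    ... | yes v<w =
      let (nadir≼v , v≼w) = track-between nadir≼x on-track (subst (_≤ level v) (sym level-nadir) z≤n) (<⇒≤ v<w)
      in All.lookup (proj₂ (proj₂ visible)) (passes-above nadir≼v v≼w v<w) (proj₁ (∈-L⁻ v∈L))
    ... | no  v≮w with w ≟ᵛ v
    ...   | yes refl = L∩U-empty v∈L w∈U
    ...   | no  w≢v  = let (t , t∈X , t≺w) = find (proj₂ (∈-U⁻ w∈U))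
                       in no-three-chain t∈X (proj₁ (∈-U⁻ w∈U)) (proj₁ (∈-L⁻ v∈L)) t≺w
                                         (track-above nadir≼x on-track (≮⇒≥ v≮w) , w≢v)

  -- One of L, U has all 2^d vertices an antichain can have and the other more than 2^(d-1);
  -- the twins lemmas then bound the full one below 2^d.
  not-too-long : 1 ≤ n → ¬ (2 ^ suc n + 2 ^ suc n ≤ suc (length U + length L))
  not-too-long 1≤n too-long with length U <? 2 ^ suc n
  ... | yes U-small with twins-or-length-≤ fzero U-antichain U-unique
  ...   | inj₁ (w , w′ , w∈ , w′∈ , twins) = <⇒≱ (U-twins⇒L-small w∈ w′∈ twins) (full-part too-long U-small)
  ...   | inj₂ U≤half = <⇒≱ (large-part 1≤n too-long (length-antichain-≤ L-antichain L-unique)) U≤half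
  not-too-long 1≤n too-long | no U-full with twins-or-length-≤ (fromℕ n) L-antichain L-unique
  ...   | inj₁ (v , v′ , v∈ , v′∈ , twins) = U-full (L-twins⇒U-small v∈ v′∈ twins (below-top v∈) (below-top v′∈))
    where
    below-top : ∀ {v} → v ∈ L → level v ≤ n
    below-top {v} v∈L with level v ≟ suc n
    ... | yes v-top = contradiction (L-at-top⇒U-small v∈L v-top) U-full
    ... | no  v≢top = s≤s⁻¹ (≤∧≢⇒< (level≤d v) v≢top)
  ...   | inj₂ L≤half = <⇒≱ (large-part 1≤n too-long′ (length-antichain-≤ U-antichain U-unique)) L≤half
    where too-long′ = subst (λ m → 2 ^ suc n + 2 ^ suc n ≤ suc m) (+-comm (length U) (length L)) too-long

  length-≤ : 1 ≤ n → length X ≤ 2 ^ (suc n + 1) ∸ 2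
  length-≤ 1≤n with length X ≤? 2 ^ (suc n + 1) ∸ 2
  ... | yes fits     = fits
  ... | no  too-long = contradiction (begin
    2 ^ suc n + 2 ^ suc n           ≡⟨ 2^[n+1]≡2^+2^ (suc n) ⟨
    2 ^ (suc n + 1)                 ≡⟨ m∸n+n≡m 2≤M ⟨
    (2 ^ (suc n + 1) ∸ 2) + 2       ≡⟨ +-comm _ 2 ⟩
    suc (suc (2 ^ (suc n + 1) ∸ 2)) ≤⟨ s≤s (≰⇒> too-long) ⟩
    suc (length X)                  ≡⟨ cong suc length-U+L ⟨
    suc (length U + length L)       ∎) (not-too-long 1≤n)
    where
    open ≤-Reasoning
    2≤M : 2 ≤ 2 ^ (suc n + 1)
    2≤M = ^-monoʳ-≤ 2 {1} {suc n + 1} (s≤s z≤n)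

theorem4 : (d : ℕ) → 2 ≤ d → IsMu (BAdj d) (2 ^ (d + 1) ∸ 2)
theorem4 (suc zero) (s≤s ())
theorem4 d@(suc (suc _)) _ =
  (X₀ d , X₀-unique (s≤s z≤n) , X₀-mutually-visible d , length-X₀ d) ,
  λ X unique visible → UpperBound.length-≤ X unique visible (s≤s z≤n)
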